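{- Let $(X,\le)$ be a poset, $E$ an equivalence relation on $X$ with ${\le}\subseteq E$, and $\alpha\colon X\to X$ an order automorphism of $(X,\le)$ with $\alpha\subseteq E$. Set $0=\alpha\circ(\le^{c})^{\smile}=(\le^{c})^{\smile}\circ\alpha$. Then for all $R\in\mathsf{Up}(\mathbf E)$: (i) ${\sim}^nR=(\alpha^{\smile})^{\frac{n-1}{2}}\circ(R^{c})^{\smile}\circ\alpha^{\frac{n+1}{2}}$ for all odd $n\ge1$; (ii) ${\sim}^nR=(\alpha^{\smile})^{\frac n2}\circ R\circ\alpha^{\frac n2}$ for all even $n\ge2$; (iii) ${ - }^nR=\alpha^{\frac{n+1}{2}}\circ(R^{c})^{\smile}\circ(\alpha^{\smile})^{\frac{n-1}{2}}$ for all odd $n\ge1$; (iv) ${ - }^nR=\alpha^{\frac n2}\circ R\circ(\alpha^{\smile})^{\frac n2}$ for all even $n\ge2$.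
   Context: Relations: $R\circ S=\{(x,y)\mid\exists z\,((x,z)\in R,(z,y)\in S)\}$, $R^{\smile}$ the converse; functions are identified with their graphs; $\gamma^0=\mathrm{id}_X$, $\gamma^{k+1}=\gamma^k\circ\gamma$, and similarly for powers of the relation $\alpha^{\smile}$. Order automorphism: bijection with $x\le y\iff\alpha(x)\le\alpha(y)$. $E$ is ordered by $(u,v)\preceq(x,y)$ iff $x\le u$ and $v\le y$; $\mathsf{Up}(\mathbf E)$ is the set of up-sets of $(E,\preceq)$; $R^{c}=E\setminus R$. On $\mathsf{Up}(\mathbf E)$, ${\sim}R=R\backslash0=(R^{\smile}\circ0^{c})^{c}$ and ${ - }R=0/R=(0^{c}\circ R^{\smile})^{c}$; ${\sim}^n,{ - }^n$ denote $n$-fold applications. -}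

module Defs where

open import Data.Nat using (ℕ; zero; suc)
open import Data.Product using (Σ; ∃; _×_; _,_)
open import Relation.Nullary using (¬_)
open import Relation.Binary.PropositionalEquality using (_≡_)
open import Function.Bundles using (_⇔_)

BRel : Set → Set₁
BRel X = X → X → Set

module _ {X : Set} where

  _⨾_ : BRel X → BRel X → BRel X
  (R ⨾ S) x y = ∃ λ z → R x z × S z y
  infixl 7 _⨾_

  _˘ : BRel X → BRel X
  (R ˘) x y = R y x
  infix 9 _˘

  idR : BRel X
  idR x y = x ≡ y

  graph : (X → X) → BRel X
  graph f x y = f x ≡ y

  _^ʳ_ : BRel X → ℕ → BRel X
  R ^ʳ zero  = idR
  R ^ʳ suc k = (R ^ʳ k) ⨾ R

  compl : BRel X → BRel X → BRel X
  compl E R x y = E x y × ¬ R x y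

  _≐_ : BRel X → BRel X → Set
  R ≐ S = ∀ x y → R x y ⇔ S x y
  infix 4 _≐_

  -- R ∈ Up(E): R ⊆ E and R is an up-set of (E, ⪯),
  -- where (u,v) ⪯ (x,y) iff x ≤ u and v ≤ y.
  IsUp : BRel X → BRel X → BRel X → Set
  IsUp _≤_ E R =
    (∀ x y → R x y → E x y) ×
    (∀ u v x y → E u v → E x y → x ≤ u → v ≤ y → R u v → R x y)

  zeroR : BRel X → BRel X → (X → X) → BRel X
  zeroR _≤_ E α = graph α ⨾ (compl E _≤_ ˘)

  -- ∼R = R \ 0 = (R˘ ∘ 0^c)^c   and   −R = 0 / R = (0^c ∘ R˘)^c
  ∼[_,_,_] : BRel X → BRel X → (X → X) → BRel X → BRel X
  ∼[ _≤_ , E , α ] R = compl E ((R ˘) ⨾ compl E (zeroR _≤_ E α))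

  −[_,_,_] : BRel X → BRel X → (X → X) → BRel X → BRel X
  −[ _≤_ , E , α ] R = compl E (compl E (zeroR _≤_ E α) ⨾ (R ˘))

iter : {A : Set₁} → ℕ → (A → A) → A → A
iter zero    f a = a
iter (suc n) f a = f (iter n f a)

-- Write β for α⁻¹. For an up-set S one has ∼S x y ⇔ E x y ∧ ¬ S (β y) x and
-- −S x y ⇔ E x y ∧ ¬ S y (α x), i.e. ∼S and −S are the E-complement of S˘ pulled
-- back along (id, β), resp. (α, id). Pulling back along monotone maps that preserve
-- E-classes commutes with E-complement and preserves up-sets, so every application
-- of ∼ (or −) swaps R with (Rᶜ)˘ and adds one shift; two applications give back R
-- (by excluded middle), shifted by β (or α) on both sides. Finally, relational
-- powers of the graph of α are graphs of iterates of α or β, and composing with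
-- graphs on both sides is exactly pulling back.
module Submission where

open import Defs
open import Data.Nat using (zero; suc; _*_)
open import Data.Nat.Properties using (*-suc)
open import Data.Product using (_×_; _,_; proj₁; proj₂)
open import Function using (_∘_; id)
open import Function.Bundles using (_⇔_; mk⇔; Equivalence; mk⤖; Inverse)
open import Function.Construct.Composition using (_⇔-∘_)
open import Function.Construct.Symmetry using (⇔-sym)
open import Function.Definitions using (Bijective)
open import Function.Properties.Bijection using (⤖⇒↔)
import Function.Endo.Propositional as Endo
open import Relation.Binary.PropositionalEquality
  using (_≡_; refl; sym; trans; cong; subst; subst₂; _≗_)
open import Relation.Binary.Structures using (IsPartialOrder; IsEquivalence)
open import Axiom.ExcludedMiddle using (ExcludedMiddle)
open import Axiom.DoubleNegationElimination using (DoubleNegationElimination; em⇒dne)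
open import Level using (0ℓ)

open Equivalence using (to; from)

module _ {X : Set} where

  open Endo X using (_^_)

  private variable
    A C S T U : BRel X
    f f′ g g′ : X → X

  ≐-refl : S ≐ S
  ≐-refl x y = mk⇔ id id

  ≐-sym : S ≐ T → T ≐ S
  ≐-sym S≐T x y = ⇔-sym (S≐T x y)

  ≐-trans : S ≐ T → T ≐ U → S ≐ U
  ≐-trans S≐T T≐U x y = T≐U x y ⇔-∘ S≐T x y

  ≡⇒≐ : S ≡ T → S ≐ T
  ≡⇒≐ refl = ≐-refl

  ˘-cong : S ≐ T → S ˘ ≐ T ˘
  ˘-cong S≐T x y = S≐T y x

  pullback : BRel X → (X → X) → (X → X) → BRel X
  pullback S f g x y = S (f x) (g y)

  pullback-cong : S ≐ T → pullback S f g ≐ pullback T f g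
  pullback-cong {f = f} {g = g} S≐T x y = S≐T (f x) (g y)

  pullback-≗ : f ≗ f′ → g ≗ g′ → pullback S f g ≐ pullback S f′ g′
  pullback-≗ {S = S} f≗f′ g≗g′ x y =
    mk⇔ (subst₂ S (f≗f′ x) (g≗g′ y)) (subst₂ S (sym (f≗f′ x)) (sym (g≗g′ y)))

  ^-slide : ∀ (b a : X → X) k → ((b ∘ a) ^ k) ∘ b ≗ b ∘ ((a ∘ b) ^ k)
  ^-slide b a zero    x = refl
  ^-slide b a (suc k) x = cong (b ∘ a) (^-slide b a k x)

  ^-comm : ∀ (f : X → X) k → (f ^ k) ∘ f ≗ f ∘ (f ^ k)
  ^-comm f = ^-slide f id

  ^-inverse : g ∘ f ≗ id → ∀ k → (g ^ k) ∘ (f ^ k) ≗ id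
  ^-inverse gf zero    x = refl
  ^-inverse {g = g} {f = f} gf (suc k) x =
    trans (sym (^-comm g k (f ((f ^ k) x))))
          (trans (cong (g ^ k) (gf ((f ^ k) x))) (^-inverse gf k x))

  graph˘-inverse : g ∘ f ≗ id → f ∘ g ≗ id → graph f ˘ ≐ graph g
  graph˘-inverse {g = g} {f = f} gf fg x y =
    mk⇔ (λ fy≡x → trans (cong g (sym fy≡x)) (gf y))
        (λ gx≡y → trans (cong f (sym gx≡y)) (fg x))

  ^ʳ-graph : A ≐ graph f → ∀ k → A ^ʳ k ≐ graph (f ^ k)
  ^ʳ-graph A≐f zero = ≐-refl
  ^ʳ-graph {f = f} A≐f (suc k) x y = mk⇔
    (λ { (z , p , q) → trans (cong f (to (^ʳ-graph A≐f k x z) p)) (to (A≐f z y) q) })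
    (λ e → (f ^ k) x , from (^ʳ-graph A≐f k x _) refl , from (A≐f _ y) e)

  ⨾-⨾-pullback : A ≐ graph f → C ≐ graph g ˘ → A ⨾ S ⨾ C ≐ pullback S f g
  ⨾-⨾-pullback {S = S} A≐f C≐g˘ x y = mk⇔
    (λ { (w , (z , a , s) , c) →
         subst₂ S (sym (to (A≐f x z) a)) (sym (to (C≐g˘ w y) c)) s })
    (λ s → _ , (_ , from (A≐f x _) refl , s) , from (C≐g˘ _ y) refl)

module UpSets {X : Set} (_≤_ E : BRel X) (E-isEquivalence : IsEquivalence E) where

  open IsEquivalence E-isEquivalence
    renaming (refl to E-refl; sym to E-sym; trans to E-trans)
  open Endo X using (_^_)

  private variable
    S : BRel X
    f g : X → X

  Admissible : (X → X) → Set
  Admissible f = (∀ x → E x (f x)) × (∀ {x y} → x ≤ y → f x ≤ f y)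

  id-admissible : Admissible id
  id-admissible = (λ _ → E-refl) , id

  ∘-admissible : Admissible f → Admissible g → Admissible (f ∘ g)
  ∘-admissible (f-E , f-mono) (g-E , g-mono) =
    (λ x → E-trans (g-E x) (f-E _)) , f-mono ∘ g-mono

  ^-admissible : Admissible f → ∀ k → Admissible (f ^ k)
  ^-admissible f-adm zero    = id-admissible
  ^-admissible f-adm (suc k) = ∘-admissible f-adm (^-admissible f-adm k)

  E-pullback : Admissible f → Admissible g → E ≐ pullback E f g
  E-pullback (f-E , _) (g-E , _) x y = mk⇔
    (λ e → E-trans (E-sym (f-E x)) (E-trans e (g-E y)))
    (λ e → E-trans (f-E x) (E-trans e (E-sym (g-E y))))

  compl-pullback : Admissible f → Admissible g →
                   compl E (pullback S f g) ≐ pullback (compl E S) f g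
  compl-pullback f-adm g-adm x y = mk⇔
    (λ { (e , ¬s) → to (E-pullback f-adm g-adm x y) e , ¬s })
    (λ { (e , ¬s) → from (E-pullback f-adm g-adm x y) e , ¬s })

  pullback-isUp : Admissible f → Admissible g → IsUp _≤_ E S → IsUp _≤_ E (pullback S f g)
  pullback-isUp f-adm g-adm (S⊆E , S-up) =
    (λ x y s → from (E-pullback f-adm g-adm x y) (S⊆E _ _ s)) ,
    (λ u v x y _ exy x≤u v≤y s →
       S-up _ _ _ _ (S⊆E _ _ s) (to (E-pullback f-adm g-adm x y) exy)
            (proj₂ f-adm x≤u) (proj₂ g-adm v≤y) s)

  compl-˘-isUp : IsUp _≤_ E S → IsUp _≤_ E (compl E S ˘)
  compl-˘-isUp (S⊆E , S-up) =
    (λ { x y (e , _) → E-sym e }) ,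
    (λ { u v x y _ exy x≤u v≤y (e , ¬s) →
           E-sym exy , λ s → ¬s (S-up y x v u (S⊆E y x s) e v≤y x≤u s) })

  compl-compl-˘ : DoubleNegationElimination 0ℓ → (∀ x y → S x y → E x y) →
                  compl E (compl E S ˘) ˘ ≐ S
  compl-compl-˘ dne S⊆E x y = mk⇔
    (λ { (e , ¬c) → dne (λ ¬s → ¬c (E-sym e , ¬s)) })
    (λ s → E-sym (S⊆E x y s) , λ { (_ , ¬s) → ¬s s })

  -- Φ stands for ∼ (with a = id, b = β) and for − (with a = α, b = id).
  module Iteration
      (dne : DoubleNegationElimination 0ℓ)
      (Φ : BRel X → BRel X) (Φ-cong : ∀ {S T} → S ≐ T → Φ S ≐ Φ T)
      {a b : X → X} (a-adm : Admissible a) (b-adm : Admissible b)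
      (Φ-char : ∀ {S} → IsUp _≤_ E S → Φ S ≐ pullback (compl E S ˘) a b)
      {R : BRel X} (R-up : IsUp _≤_ E R) where

    Φ-pullback : IsUp _≤_ E S → Admissible f → Admissible g →
                 Φ (pullback S f g) ≐ pullback (compl E S ˘) (g ∘ a) (f ∘ b)
    Φ-pullback {S = S} S-up f-adm g-adm =
      ≐-trans (Φ-char (pullback-isUp {S = S} f-adm g-adm S-up))
              (pullback-cong (˘-cong (compl-pullback {S = S} f-adm g-adm)))

    Φ²-pullback : IsUp _≤_ E S → Admissible f → Admissible g →
                  Φ (Φ (pullback S f g)) ≐ pullback S (f ∘ b ∘ a) (g ∘ a ∘ b)
    Φ²-pullback S-up f-adm g-adm =
      ≐-trans (Φ-cong (Φ-pullback S-up f-adm g-adm))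
      (≐-trans (Φ-pullback (compl-˘-isUp S-up) (∘-admissible g-adm a-adm) (∘-admissible f-adm b-adm))
               (pullback-cong (compl-compl-˘ dne (proj₁ S-up))))

    iterate-even : ∀ k → iter (2 * k) Φ R ≐ pullback R ((b ∘ a) ^ k) ((a ∘ b) ^ k)
    iterate-even zero = ≐-refl
    iterate-even (suc k) =
      ≐-trans (≡⇒≐ (cong (λ n → iter n Φ R) (*-suc 2 k)))
      (≐-trans (Φ-cong (Φ-cong (iterate-even k)))
      (≐-trans (Φ²-pullback R-up (^-admissible (∘-admissible b-adm a-adm) k)
                                 (^-admissible (∘-admissible a-adm b-adm) k))
               (pullback-≗ {S = R} (^-comm (b ∘ a) k) (^-comm (a ∘ b) k))))

    iterate-odd : ∀ k → iter (suc (2 * k)) Φ R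
                      ≐ pullback (compl E R ˘) (a ∘ ((b ∘ a) ^ k)) (b ∘ ((a ∘ b) ^ k))
    iterate-odd k =
      ≐-trans (Φ-cong (iterate-even k))
      (≐-trans (Φ-pullback R-up (^-admissible (∘-admissible b-adm a-adm) k)
                                (^-admissible (∘-admissible a-adm b-adm) k))
               (pullback-≗ {S = compl E R ˘} (^-slide a b k) (^-slide b a k)))

module Residuals
    {X : Set} (_≤_ E : BRel X) (E-isEquivalence : IsEquivalence E)
    (≤-refl : ∀ {x} → x ≤ x)
    (α β : X → X) (βα : β ∘ α ≗ id) (αβ : α ∘ β ≗ id)
    (α-≤-iff : ∀ x y → (x ≤ y) ⇔ (α x ≤ α y)) (α-E : ∀ x → E x (α x)) where

  open IsEquivalence E-isEquivalence using () renaming (sym to E-sym; trans to E-trans)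
  open UpSets _≤_ E E-isEquivalence
  open Endo X using (_^_)

  private variable
    S T : BRel X

  ∼ − : BRel X → BRel X
  ∼ = ∼[ _≤_ , E , α ]
  − = −[ _≤_ , E , α ]

  β-E : ∀ x → E x (β x)
  β-E x = E-sym (subst (E (β x)) (αβ x) (α-E (β x)))

  α-admissible : Admissible α
  α-admissible = α-E , to (α-≤-iff _ _)

  β-admissible : Admissible β
  β-admissible = β-E , λ {x} {y} x≤y →
    from (α-≤-iff (β x) (β y)) (subst₂ _≤_ (sym (αβ x)) (sym (αβ y)) x≤y)

  ∼-char : IsUp _≤_ E S → ∼ S ≐ pullback (compl E S ˘) id β
  ∼-char {S} (S⊆E , S-up) x y = mk⇔
    (λ { (exy , h) → E-trans (E-sym (β-E y)) (E-sym exy) ,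
                     λ s → h (β y , s , E-sym (β-E y) , λ { (_ , refl , _ , y≰) → y≰ y≤αβy }) })
    (λ { (e , ¬s) → E-trans (E-sym e) (E-sym (β-E y)) ,
         λ { (z , s , ezy , ¬0) → ¬0 (α z , refl , E-trans (E-sym ezy) (α-E z) ,
               λ y≤αz → ¬s (S-up z x (β y) x (S⊆E z x s) e (βy≤ y≤αz) ≤-refl s)) } })
    where
    y≤αβy : y ≤ α (β y)
    y≤αβy = subst (y ≤_) (sym (αβ y)) ≤-refl
    βy≤ : ∀ {z} → y ≤ α z → β y ≤ z
    βy≤ {z} y≤αz = from (α-≤-iff (β y) z) (subst (_≤ α z) (sym (αβ y)) y≤αz)

  −-char : IsUp _≤_ E S → − S ≐ pullback (compl E S ˘) α id
  −-char {S} (S⊆E , S-up) x y = mk⇔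
    (λ { (exy , h) → E-trans (E-sym exy) (α-E x) ,
                     λ s → h (α x , (α-E x , λ { (_ , refl , _ , αx≰) → αx≰ ≤-refl }) , s) })
    (λ { (e , ¬s) → E-trans (α-E x) (E-sym e) ,
         λ { (z , (exz , ¬0) , s) → ¬0 (α x , refl , E-trans (E-sym exz) (α-E x) ,
               λ z≤αx → ¬s (S-up y z y (α x) (S⊆E y z s) e ≤-refl z≤αx s)) } })

  ∼-cong : S ≐ T → ∼ S ≐ ∼ T
  ∼-cong S≐T x y = mk⇔
    (λ { (exy , h) → exy , λ { (z , t , c) → h (z , from (S≐T z x) t , c) } })
    (λ { (exy , h) → exy , λ { (z , s , c) → h (z , to (S≐T z x) s , c) } })

  −-cong : S ≐ T → − S ≐ − T
  −-cong S≐T x y = mk⇔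
    (λ { (exy , h) → exy , λ { (z , c , t) → h (z , c , from (S≐T y z) t) } })
    (λ { (exy , h) → exy , λ { (z , c , s) → h (z , c , to (S≐T y z) s) } })

  graph-α˘-^ʳ : ∀ k → (graph α ˘) ^ʳ k ≐ graph (β ^ k)
  graph-α˘-^ʳ = ^ʳ-graph (graph˘-inverse βα αβ)

  graph-α˘-^ʳ-as-converse : ∀ k → (graph α ˘) ^ʳ k ≐ graph (α ^ k) ˘
  graph-α˘-^ʳ-as-converse k =
    ≐-trans (graph-α˘-^ʳ k) (≐-sym (graph˘-inverse (^-inverse βα k) (^-inverse αβ k)))

  graph-α-^ʳ : ∀ k → graph α ^ʳ k ≐ graph (α ^ k)
  graph-α-^ʳ = ^ʳ-graph ≐-refl

  graph-α-^ʳ-as-converse : ∀ k → graph α ^ʳ k ≐ graph (β ^ k) ˘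
  graph-α-^ʳ-as-converse k =
    ≐-trans (graph-α-^ʳ k) (≐-sym (graph˘-inverse (^-inverse αβ k) (^-inverse βα k)))

  module _ (dne : DoubleNegationElimination 0ℓ) {R : BRel X} (R-up : IsUp _≤_ E R) where

    private
      module ∼-iterates = Iteration dne ∼ ∼-cong id-admissible β-admissible ∼-char R-up
      module −-iterates = Iteration dne − −-cong α-admissible id-admissible −-char R-up

    ∼-iterate-odd : ∀ k → iter (suc (2 * k)) ∼ R
                        ≐ ((graph α ˘) ^ʳ k) ⨾ (compl E R ˘) ⨾ (graph α ^ʳ suc k)
    ∼-iterate-odd k = ≐-trans (∼-iterates.iterate-odd k)
      (≐-sym (⨾-⨾-pullback (graph-α˘-^ʳ k) (graph-α-^ʳ-as-converse (suc k))))

    ∼-iterate-even : ∀ k → iter (2 * k) ∼ R ≐ ((graph α ˘) ^ʳ k) ⨾ R ⨾ (graph α ^ʳ k)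
    ∼-iterate-even k = ≐-trans (∼-iterates.iterate-even k)
      (≐-sym (⨾-⨾-pullback (graph-α˘-^ʳ k) (graph-α-^ʳ-as-converse k)))

    −-iterate-odd : ∀ k → iter (suc (2 * k)) − R
                        ≐ (graph α ^ʳ suc k) ⨾ (compl E R ˘) ⨾ ((graph α ˘) ^ʳ k)
    −-iterate-odd k = ≐-trans (−-iterates.iterate-odd k)
      (≐-sym (⨾-⨾-pullback (graph-α-^ʳ (suc k)) (graph-α˘-^ʳ-as-converse k)))

    −-iterate-even : ∀ k → iter (2 * k) − R ≐ (graph α ^ʳ k) ⨾ R ⨾ ((graph α ˘) ^ʳ k)
    −-iterate-even k = ≐-trans (−-iterates.iterate-even k)
      (≐-sym (⨾-⨾-pullback (graph-α-^ʳ k) (graph-α˘-^ʳ-as-converse k)))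

lemma3p11 : ExcludedMiddle 0ℓ →
    (X : Set) (_≤_ : BRel X) (E : BRel X) (α : X → X) →
    IsPartialOrder _≡_ _≤_ →
    IsEquivalence E →
    (∀ x y → x ≤ y → E x y) →
    Bijective _≡_ _≡_ α →
    (∀ x y → (x ≤ y) ⇔ (α x ≤ α y)) →
    (∀ x → E x (α x)) →
    (R : BRel X) → IsUp _≤_ E R →
    (∀ k → iter (suc (2 * k)) ∼[ _≤_ , E , α ] R
             ≐ ((graph α ˘) ^ʳ k) ⨾ (compl E R ˘) ⨾ (graph α ^ʳ suc k)) ×
    (∀ k → iter (2 * suc k) ∼[ _≤_ , E , α ] R
             ≐ ((graph α ˘) ^ʳ suc k) ⨾ R ⨾ (graph α ^ʳ suc k)) ×
    (∀ k → iter (suc (2 * k)) −[ _≤_ , E , α ] R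
             ≐ (graph α ^ʳ suc k) ⨾ (compl E R ˘) ⨾ ((graph α ˘) ^ʳ k)) ×
    (∀ k → iter (2 * suc k) −[ _≤_ , E , α ] R
             ≐ (graph α ^ʳ suc k) ⨾ R ⨾ ((graph α ˘) ^ʳ suc k))
lemma3p11 em X _≤_ E α ≤-isPartialOrder E-isEquivalence _ α-bijective α-≤-iff α-E R R-up =
  ∼-iterate-odd dne R-up , ∼-iterate-even dne R-up ∘ suc ,
  −-iterate-odd dne R-up , −-iterate-even dne R-up ∘ suc
  where
  dne : DoubleNegationElimination 0ℓ
  dne = em⇒dne em

  open Inverse (⤖⇒↔ (mk⤖ α-bijective)) using (strictlyInverseˡ; strictlyInverseʳ)
    renaming (from to α⁻¹)
  open Residuals _≤_ E E-isEquivalence (IsPartialOrder.refl ≤-isPartialOrder)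
                 α α⁻¹ strictlyInverseʳ strictlyInverseˡ α-≤-iff α-E
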